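{- Let $(G,H)$ be a Hamiltonian cubic $3$-pole and let $C$ be an alternating circuit in $(G,H)$. Let $(G',H')$ be the Hamiltonian $3$-pole obtained by suppressing $C$. If $(G',H')$ has a proper $4$-cover, then so does $(G,H)$.
   Context: Graphs may have multiple edges and dangling edges: each edge has either two end vertices or exactly one end vertex (a dangling edge); no loops. A Hamiltonian cubic $3$-pole $(G,H)$ is a graph $G$ in which every vertex has degree $3$, with exactly three dangling edges (called spokes), together with a distinguished circuit $H$ through all vertices of $G$. A chord is an edge not in $H$; $Q$ is the set of chords. An alternating circuit in $(G,H)$ is a circuit whose edges alternate between edges of $H$ and chords that are not spokes. Suppressing $C$ means deleting the chords in $C\cap Q$ and then smoothing (replacing the two incident edges by a single edge) every resulting vertex of degree $2$ on $H$; the resulting graph $G'$ with the circuit $H'$ obtained from $H$ is again a Hamiltonian cubic $3$-pole, and chords of $G$ not in $C$ remain chords of $G'$. A perfect matching is a set of edges (dangling edges allowed) covering every vertex exactly once. A proper $4$-cover of $(G,H)$ is a set of perfect matchings $M_1,M_2,M_3,M_4$ with every edge in at least one $M_i$, $M_4=Q$, and each spoke lying in exactly two of the $M_i$. -}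

module Defs where

open import Data.Nat using (ℕ; zero; suc; _+_)
open import Data.Nat.DivMod using (_mod_)
open import Data.Fin using (Fin; toℕ; #_) renaming (_<_ to _<ᶠ_)
open import Data.Bool using (Bool; true; false)
open import Data.Product using (Σ; ∃; ∃-syntax; _×_; _,_)
open import Data.Sum using (_⊎_)
open import Relation.Binary.PropositionalEquality using (_≡_; _≢_)
open import Relation.Nullary using (¬_)
open import Function.Bundles using (_⇔_)

-- Vertices are Fin n, listed in the order in which the Hamiltonian
-- circuit H traverses them.  H consists of the n edges
--   h_i = { i , next i }   (i : Fin n),
-- so H-edges are indexed by Fin n.  Each vertex has degree 3, hence
-- exactly one further edge-end, which belongs to a chord.  The chords
-- are described by an involution σ : a chord joins i and σ i when
-- σ i ≢ i, and when σ i ≡ i the chord at i is a dangling edge (spoke).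
-- A chord is thus identified with the σ-orbit {i , σ i}.

next : ∀ {n} → Fin n → Fin n
next {suc k} i = suc (toℕ i) mod suc k

prev : ∀ {n} → Fin n → Fin n
prev {suc k} i = (toℕ i + k) mod suc k

record Pole3 (n : ℕ) : Set where
  field
    σ      : Fin n → Fin n
    invol  : ∀ i → σ (σ i) ≡ i
    s₁ s₂ s₃ : Fin n
    s₁≢s₂  : s₁ ≢ s₂
    s₁≢s₃  : s₁ ≢ s₃
    s₂≢s₃  : s₂ ≢ s₃
    fix₁   : σ s₁ ≡ s₁
    fix₂   : σ s₂ ≡ s₂
    fix₃   : σ s₃ ≡ s₃
    onlySpokes : ∀ i → σ i ≡ i → i ≡ s₁ ⊎ i ≡ s₂ ⊎ i ≡ s₃

open Pole3 public

IsSpoke : ∀ {n} → Pole3 n → Fin n → Set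
IsSpoke G i = σ G i ≡ i

HEdgeBetween : ∀ {n} → Fin n → Fin n → Set
HEdgeBetween u v = next u ≡ v ⊎ next v ≡ u

record AltCircuit {n : ℕ} (G : Pole3 n) : Set where
  field
    k      : ℕ                      -- the circuit has length 2 (suc k)
    a b    : Fin (suc k) → Fin n
    a-inj  : ∀ j j' → a j ≡ a j' → j ≡ j'
    b-inj  : ∀ j j' → b j ≡ b j' → j ≡ j'
    a≢b    : ∀ j j' → a j ≢ b j'
    hEdge  : ∀ j → HEdgeBetween (a j) (b j)
    chord  : ∀ j → σ G (b j) ≡ a (next j)
    notSpoke : ∀ j → ¬ IsSpoke G (b j)

open AltCircuit public

InC : ∀ {n} {G : Pole3 n} → AltCircuit G → Fin n → Set
InC C v = ∃[ j ] (a C j ≡ v ⊎ b C j ≡ v)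

-- Deleting the chords of C leaves every vertex of C with
-- degree 2 (only its two H-edges); smoothing them yields the 3-pole on
-- the remaining vertices, in the same cyclic order, with the remaining
-- chords.  G' : Pole3 m is the result of suppressing C, where
-- f : Fin m → Fin n is the (unique) increasing enumeration of the
-- vertices not in C, and chords/spokes of G' are those of G.

record IsSuppression {n m : ℕ} (G : Pole3 n) (C : AltCircuit G)
                     (G' : Pole3 m) (f : Fin m → Fin n) : Set where
  field
    increasing : ∀ i j → i <ᶠ j → f i <ᶠ f j
    image      : ∀ v → (¬ InC C v) ⇔ (∃[ j ] f j ≡ v)
    chords     : ∀ j → f (σ G' j) ≡ σ G (f j)

-- Edge sets, perfect matchings, proper 4-covers.
-- An edge set is given by membership of each H-edge (mH) and of each
-- chord (mQ, constant on σ-orbits, i.e. on chords).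

record EdgeSet {n : ℕ} (G : Pole3 n) : Set where
  field
    mH    : Fin n → Bool
    mQ    : Fin n → Bool
    mQ-σ  : ∀ i → mQ (σ G i) ≡ mQ i

open EdgeSet public

one : Bool → ℕ
one true  = 1
one false = 0

-- vertex i is incident with H-edges (prev i) and i, and with its chord
IsPerfectMatching : ∀ {n} {G : Pole3 n} → EdgeSet G → Set
IsPerfectMatching M =
  ∀ i → one (mH M (prev i)) + one (mH M i) + one (mQ M i) ≡ 1

record Proper4Cover {n : ℕ} (G : Pole3 n) : Set where
  field
    M        : Fin 4 → EdgeSet G
    perfect  : ∀ t → IsPerfectMatching (M t)
    M₄=Q     : ∀ i → (mH (M (# 3)) i ≡ false) × (mQ (M (# 3)) i ≡ true)
    coverH   : ∀ i → ∃[ t ] mH (M t) i ≡ true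
    coverQ   : ∀ i → ∃[ t ] mQ (M t) i ≡ true
    spokes2  : ∀ i → IsSpoke G i →
               one (mQ (M (# 0)) i) + one (mQ (M (# 1)) i)
                 + one (mQ (M (# 2)) i) + one (mQ (M (# 3)) i) ≡ 2

-- Each H'-edge of G' is subdivided in G by a path whose inner vertices lie on C and whose
-- edges alternate between edges of C and edges off C, because every vertex of C lies on
-- exactly one H-edge of C. A perfect matching of G' therefore lifts to one of G: keep its
-- chords, and give each H-edge of G the membership of its H'-edge, flipped on the edges
-- of C. Lifting M₁, M₂, M₃ and taking M₄ = Q gives a proper 4-cover of G. An H-edge of C
-- is covered by a lifted matching that avoids its H'-edge w, namely the one covering the
-- H'-edge before w; spokes are off C, so they keep their multiplicities.

module Submission where

open import Defs
open import Data.Nat using (ℕ; zero; suc; _+_; _*_; _%_; _≤_; _<_; z≤n; s≤s; s≤s⁻¹)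
open import Data.Nat.Properties
  using (+-suc; +-comm; +-cancelˡ-≡; ≤-refl; ≤-reflexive; <⇒≤; <⇒≢; <⇒≱; ≤⇒≯; ≰⇒>;
         m≤n⇒m<n∨m≡n; <-cmp)
open import Data.Nat.DivMod
  using (%-distribˡ-+; m%n%n≡m%n; [m+n]%n≡m%n; m<n⇒m%n≡m; m≡m%n+[m/n]*n; _/_)
open import Data.Fin using (Fin; zero; suc; toℕ; fromℕ; #_)
open import Data.Fin.Properties
  using (toℕ-injective; toℕ-fromℕ<; toℕ-fromℕ; toℕ<n; ≤fromℕ; any?; injective⇒≤)
import Data.Fin as Fin
open import Data.Bool using (Bool; true; false; not; _xor_)
open import Data.Product using (∃; ∃-syntax; _×_; _,_; proj₁; proj₂)
open import Data.Sum using (_⊎_; inj₁; inj₂)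
import Data.Sum as Sum
open import Data.Empty using (⊥)
open import Relation.Nullary using (¬_; Dec; yes; no; does; contradiction)
open import Relation.Nullary.Decidable using (_⊎-dec_; _×-dec_; dec-false; decidable-stable)
open import Relation.Binary using (tri<; tri≈; tri>)
open import Relation.Binary.PropositionalEquality
open import Function.Base using (_∘_)
open import Function.Bundles using (Equivalence)
open import Function.Definitions using (Injective)
open ≡-Reasoning

does-complement : ∀ {a b} {X : Set a} {Y : Set b} (x? : Dec X) (y? : Dec Y) →
                  (X → ¬ Y) → X ⊎ Y → does x? ≡ not (does y?)
does-complement (yes x) (yes y) exclusive _        = contradiction y (exclusive x)
does-complement (yes _) (no _)  _         _        = refl
does-complement (no _)  (yes _) _         _        = refl
does-complement (no ¬x) (no _)  _         (inj₁ x) = contradiction x ¬x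
does-complement (no _)  (no ¬y) _         (inj₂ y) = contradiction y ¬y

only-one : ∀ {x y z} → one x + one y + one z ≡ 1 → x ≡ true → y ≡ false
only-one {true} {false} _  _ = refl
only-one {true} {true}  () _

one-xor-complement : ∀ c x → one (not c xor x) + one (c xor x) + 0 ≡ 1
one-xor-complement false false = refl
one-xor-complement false true  = refl
one-xor-complement true  false = refl
one-xor-complement true  true  = refl

module _ {p : ℕ} where

  toℕ-next : (i : Fin (suc p)) → toℕ (next i) ≡ suc (toℕ i) % suc p
  toℕ-next i = toℕ-fromℕ< _

  toℕ-prev : (i : Fin (suc p)) → toℕ (prev i) ≡ (toℕ i + p) % suc p
  toℕ-prev i = toℕ-fromℕ< _

  [m%n+k]%n≡[m+k]%n : ∀ m k → (m % suc p + k) % suc p ≡ (m + k) % suc p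
  [m%n+k]%n≡[m+k]%n m k = begin
    (m % suc p + k) % suc p                 ≡⟨ %-distribˡ-+ (m % suc p) k (suc p) ⟩
    (m % suc p % suc p + k % suc p) % suc p ≡⟨ cong (λ x → (x + k % suc p) % suc p) (m%n%n≡m%n m (suc p)) ⟩
    (m % suc p + k % suc p) % suc p         ≡⟨ %-distribˡ-+ m k (suc p) ⟨
    (m + k) % suc p                         ∎

  [1+m%n]%n≡[1+m]%n : ∀ m → suc (m % suc p) % suc p ≡ suc m % suc p
  [1+m%n]%n≡[1+m]%n m = begin
    suc (m % suc p) % suc p ≡⟨ cong (_% suc p) (+-comm 1 (m % suc p)) ⟩
    (m % suc p + 1) % suc p ≡⟨ [m%n+k]%n≡[m+k]%n m 1 ⟩
    (m + 1) % suc p         ≡⟨ cong (_% suc p) (+-comm m 1) ⟩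
    suc m % suc p           ∎

  [i+n]%n≡i : (i : Fin (suc p)) → (toℕ i + suc p) % suc p ≡ toℕ i
  [i+n]%n≡i i = trans ([m+n]%n≡m%n (toℕ i) (suc p)) (m<n⇒m%n≡m (toℕ<n i))

  next-prev : (i : Fin (suc p)) → next (prev i) ≡ i
  next-prev i = toℕ-injective (begin
    toℕ (next (prev i))               ≡⟨ toℕ-next (prev i) ⟩
    suc (toℕ (prev i)) % suc p        ≡⟨ cong (λ x → suc x % suc p) (toℕ-prev i) ⟩
    suc ((toℕ i + p) % suc p) % suc p ≡⟨ [1+m%n]%n≡[1+m]%n (toℕ i + p) ⟩
    suc (toℕ i + p) % suc p           ≡⟨ cong (_% suc p) (+-suc (toℕ i) p) ⟨
    (toℕ i + suc p) % suc p           ≡⟨ [i+n]%n≡i i ⟩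
    toℕ i                             ∎)

  prev-next : (i : Fin (suc p)) → prev (next i) ≡ i
  prev-next i = toℕ-injective (begin
    toℕ (prev (next i))               ≡⟨ toℕ-prev (next i) ⟩
    (toℕ (next i) + p) % suc p        ≡⟨ cong (λ x → (x + p) % suc p) (toℕ-next i) ⟩
    (suc (toℕ i) % suc p + p) % suc p ≡⟨ [m%n+k]%n≡[m+k]%n (suc (toℕ i)) p ⟩
    suc (toℕ i + p) % suc p           ≡⟨ cong (_% suc p) (+-suc (toℕ i) p) ⟨
    (toℕ i + suc p) % suc p           ≡⟨ [i+n]%n≡i i ⟩
    toℕ i                             ∎)

  toℕ-prev-zero : toℕ (prev {suc p} zero) ≡ p
  toℕ-prev-zero = trans (toℕ-prev zero) (m<n⇒m%n≡m ≤-refl)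

  toℕ-prev-suc : (i : Fin p) → toℕ (prev (suc i)) ≡ toℕ i
  toℕ-prev-suc i = begin
    toℕ (prev (suc i))      ≡⟨ toℕ-prev (suc i) ⟩
    suc (toℕ i + p) % suc p ≡⟨ cong (_% suc p) (+-suc (toℕ i) p) ⟨
    (toℕ i + suc p) % suc p ≡⟨ [m+n]%n≡m%n (toℕ i) (suc p) ⟩
    toℕ i % suc p           ≡⟨ m<n⇒m%n≡m (<⇒≤ (s≤s (toℕ<n i))) ⟩
    toℕ i                   ∎

-- next (next i) ≡ i would make 3 + p divide 2.
next≢prev : ∀ {p} (i : Fin (3 + p)) → next i ≢ prev i
next≢prev {p} i next≡prev = 2≢multiple q (+-cancelˡ-≡ (toℕ i) 2 (q * (3 + p)) (begin
    toℕ i + 2                           ≡⟨ +-comm (toℕ i) 2 ⟩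
    2 + toℕ i                           ≡⟨ m≡m%n+[m/n]*n (2 + toℕ i) (3 + p) ⟩
    (2 + toℕ i) % (3 + p) + q * (3 + p) ≡⟨ cong (_+ q * (3 + p)) twoSteps ⟩
    toℕ i + q * (3 + p)                 ∎))
  where
  q : ℕ
  q = (2 + toℕ i) / (3 + p)

  twoSteps : (2 + toℕ i) % (3 + p) ≡ toℕ i
  twoSteps = begin
    (2 + toℕ i) % (3 + p)                 ≡⟨ [1+m%n]%n≡[1+m]%n {suc (suc p)} (suc (toℕ i)) ⟨
    suc (suc (toℕ i) % (3 + p)) % (3 + p) ≡⟨ cong (λ x → suc x % (3 + p)) (toℕ-next i) ⟨
    suc (toℕ (next i)) % (3 + p)          ≡⟨ toℕ-next (next i) ⟨
    toℕ (next (next i))                   ≡⟨ cong (toℕ ∘ next) next≡prev ⟩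
    toℕ (next (prev i))                   ≡⟨ cong toℕ (next-prev i) ⟩
    toℕ i                                 ∎

  2≢multiple : ∀ k → 2 ≢ k * (3 + p)
  2≢multiple zero ()
  2≢multiple (suc k) ()

module StrictlyIncreasing {m p : ℕ} (f : Fin (suc m) → Fin (suc p))
  (increasing : ∀ i j → toℕ i < toℕ j → toℕ (f i) < toℕ (f j)) where

  f-mono-≤ : ∀ {i j} → toℕ i ≤ toℕ j → toℕ (f i) ≤ toℕ (f j)
  f-mono-≤ {i} {j} i≤j with m≤n⇒m<n∨m≡n i≤j
  ... | inj₁ i<j = <⇒≤ (increasing i j i<j)
  ... | inj₂ i≡j = ≤-reflexive (cong (toℕ ∘ f) (toℕ-injective i≡j))

  f-cancel-< : ∀ {i j} → toℕ (f i) < toℕ (f j) → toℕ i < toℕ j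
  f-cancel-< fi<fj = ≰⇒> (λ j≤i → ≤⇒≯ (f-mono-≤ j≤i) fi<fj)

  f-injective : ∀ {i j} → f i ≡ f j → i ≡ j
  f-injective {i} {j} fi≡fj with <-cmp (toℕ i) (toℕ j)
  ... | tri< i<j _ _ = contradiction (cong toℕ fi≡fj) (<⇒≢ (increasing i j i<j))
  ... | tri≈ _ i≡j _ = toℕ-injective i≡j
  ... | tri> _ _ j<i = contradiction (cong toℕ fi≡fj) (≢-sym (<⇒≢ (increasing j i j<i)))

  Image : ℕ → Set
  Image y = ∃[ j ] toℕ (f j) ≡ y

  image? : ∀ y → Dec (Image y)
  image? y = any? (λ j → toℕ (f j) Data.Nat.≟ y)

  preimageOr : Fin (suc m) → ℕ → Fin (suc m)
  preimageOr d y with image? y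
  ... | yes (j , _) = j
  ... | no _        = d

  preimageOr-image : ∀ d j → preimageOr d (toℕ (f j)) ≡ j
  preimageOr-image d j with image? (toℕ (f j))
  ... | yes (k , fk≡fj) = f-injective (toℕ-injective fk≡fj)
  ... | no ∉image       = contradiction (j , refl) ∉image

  preimageOr-gap : ∀ d {y} → ¬ Image y → preimageOr d y ≡ d
  preimageOr-gap d {y} ∉image with image? y
  ... | yes y∈image = contradiction y∈image ∉image
  ... | no _        = refl

  -- segment y is the index j of the last f j ≤ y, or the last index when there is none:
  -- the H-edge {y, y + 1} lies on the path that subdivides the H-edge {f j, f (next j)}.
  segment segmentBefore : ℕ → Fin (suc m)
  segment y = preimageOr (segmentBefore y) y
  segmentBefore zero    = fromℕ m
  segmentBefore (suc y) = segment y

  segment-from : ∀ {i y} → toℕ (f i) ≤ y → (∀ z → toℕ (f i) < toℕ (f z) → y < toℕ (f z)) →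
                 segment y ≡ i
  segment-from {i} fi≤y gap with m≤n⇒m<n∨m≡n fi≤y
  ... | inj₂ refl = preimageOr-image _ i
  ... | inj₁ (s≤s {n = y} fi≤y′) = begin
    preimageOr (segment y) (suc y) ≡⟨ preimageOr-gap _ gapAt1+y ⟩
    segment y                      ≡⟨ segment-from fi≤y′ (λ z fi<fz → <⇒≤ (gap z fi<fz)) ⟩
    i                              ∎
    where
    gapAt1+y : ¬ Image (suc y)
    gapAt1+y (z , fz≡1+y) = <⇒≢ (gap z (subst (toℕ (f i) <_) (sym fz≡1+y) (s≤s fi≤y′))) (sym fz≡1+y)

  segmentBefore-from : ∀ {i y} → toℕ (f i) < y → (∀ z → toℕ (f i) < toℕ (f z) → y ≤ toℕ (f z)) →
                       segmentBefore y ≡ i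
  segmentBefore-from {y = suc y} (s≤s fi≤y) gap = segment-from fi≤y gap

  segmentBefore-first : ∀ y → (∀ z → y ≤ toℕ (f z)) → segmentBefore y ≡ fromℕ m
  segmentBefore-first zero    _      = refl
  segmentBefore-first (suc y) below = begin
    preimageOr (segmentBefore y) y ≡⟨ preimageOr-gap _ (λ (z , fz≡y) → <⇒≢ (below z) (sym fz≡y)) ⟩
    segmentBefore y                ≡⟨ segmentBefore-first y (λ z → <⇒≤ (below z)) ⟩
    fromℕ m                        ∎

  segment-last : segment p ≡ fromℕ m
  segment-last = segment-from (s≤s⁻¹ (toℕ<n (f (fromℕ m))))
    (λ z flast<fz → contradiction (≤fromℕ z) (<⇒≱ (f-cancel-< flast<fz)))

  segmentBefore-prev : ∀ (v : Fin (suc p)) → segmentBefore (toℕ v) ≡ segment (toℕ (prev v))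
  segmentBefore-prev zero    = trans (sym segment-last) (cong segment (sym toℕ-prev-zero))
  segmentBefore-prev (suc v) = cong segment (sym (toℕ-prev-suc v))

  segmentBefore-image : ∀ j → segmentBefore (toℕ (f j)) ≡ prev j
  segmentBefore-image zero = begin
    segmentBefore (toℕ (f zero)) ≡⟨ segmentBefore-first _ (λ z → f-mono-≤ z≤n) ⟩
    fromℕ m                      ≡⟨ toℕ-injective (trans (toℕ-fromℕ m) (sym toℕ-prev-zero)) ⟩
    prev zero                    ∎
  segmentBefore-image (suc j) = segmentBefore-from
    (increasing _ _ (s≤s (≤-reflexive (toℕ-prev-suc j))))
    (λ z fi<fz → f-mono-≤ (subst (λ x → suc x ≤ toℕ z) (toℕ-prev-suc j) (f-cancel-< fi<fz)))

  project : Fin (suc p) → Fin (suc m)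
  project v = segment (toℕ v)

  project-image : ∀ j → project (f j) ≡ j
  project-image j = preimageOr-image _ j

  project-prev-image : ∀ j → project (prev (f j)) ≡ prev j
  project-prev-image j = trans (sym (segmentBefore-prev (f j))) (segmentBefore-image j)

  project-prev-gap : ∀ {v : Fin (suc p)} → ¬ (∃[ j ] f j ≡ v) → project (prev v) ≡ project v
  project-prev-gap {v} ∉image = begin
    segment (toℕ (prev v)) ≡⟨ segmentBefore-prev v ⟨
    segmentBefore (toℕ v)  ≡⟨ preimageOr-gap _ (λ (j , fj≡v) → ∉image (j , toℕ-injective fj≡v)) ⟨
    segment (toℕ v)        ∎

module Circuit {p : ℕ} {G : Pole3 (3 + p)} (C : AltCircuit G) where

  Joined : Fin (3 + p) → Fin (3 + p) → Set
  Joined u v = ∃[ j ] ((a C j ≡ u × b C j ≡ v) ⊎ (b C j ≡ u × a C j ≡ v))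

  CircuitEdge : Fin (3 + p) → Set
  CircuitEdge i = Joined i (next i)

  circuitEdge? : ∀ i → Dec (CircuitEdge i)
  circuitEdge? i = any? (λ j → ((a C j Fin.≟ i) ×-dec (b C j Fin.≟ next i))
                          ⊎-dec ((b C j Fin.≟ i) ×-dec (a C j Fin.≟ next i)))

  InC? : ∀ v → Dec (InC C v)
  InC? v = any? (λ j → (a C j Fin.≟ v) ⊎-dec (b C j Fin.≟ v))

  joined-sym : ∀ {u v} → Joined u v → Joined v u
  joined-sym (j , inj₁ (aj≡u , bj≡v)) = j , inj₂ (bj≡v , aj≡u)
  joined-sym (j , inj₂ (bj≡u , aj≡v)) = j , inj₁ (aj≡v , bj≡u)

  joined-functional : ∀ {u v w} → Joined u v → Joined u w → v ≡ w
  joined-functional (j , inj₁ (aj≡u , bj≡v)) (k , inj₁ (ak≡u , bk≡w)) =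
    trans (sym bj≡v) (trans (cong (b C) (a-inj C j k (trans aj≡u (sym ak≡u)))) bk≡w)
  joined-functional (j , inj₁ (aj≡u , _)) (k , inj₂ (bk≡u , _)) =
    contradiction (trans aj≡u (sym bk≡u)) (a≢b C j k)
  joined-functional (j , inj₂ (bj≡u , _)) (k , inj₁ (ak≡u , _)) =
    contradiction (trans ak≡u (sym bj≡u)) (a≢b C k j)
  joined-functional (j , inj₂ (bj≡u , aj≡v)) (k , inj₂ (bk≡u , ak≡w)) =
    trans (sym aj≡v) (trans (cong (a C) (b-inj C j k (trans bj≡u (sym bk≡u)))) ak≡w)

  InC⇒joined-along-H : ∀ {v} → InC C v → ∃[ w ] Joined v w × HEdgeBetween v w
  InC⇒joined-along-H (j , inj₁ refl) = b C j , (j , inj₁ (refl , refl)) , hEdge C j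
  InC⇒joined-along-H (j , inj₂ refl) = a C j , (j , inj₂ (refl , refl)) , swap (hEdge C j)
    where
    swap : ∀ {u v} → HEdgeBetween u v → HEdgeBetween v u
    swap (inj₁ e) = inj₂ e
    swap (inj₂ e) = inj₁ e

  InC⇒circuitEdge : ∀ {v} → InC C v → CircuitEdge v ⊎ CircuitEdge (prev v)
  InC⇒circuitEdge v∈C with InC⇒joined-along-H v∈C
  ... | w , joined , inj₁ refl = inj₁ joined
  ... | w , joined , inj₂ refl = inj₂ (subst (Joined (prev (next w))) (sym (next-prev (next w)))
                                   (joined-sym (subst (Joined (next w)) (sym (prev-next w)) joined)))

  ¬circuitEdge-both : ∀ {v} → CircuitEdge v → CircuitEdge (prev v) → ⊥
  ¬circuitEdge-both {v} here before = next≢prev v (joined-functional here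
    (joined-sym (subst (Joined (prev v)) (next-prev v) before)))

  circuitEdge-prev : ∀ {v} → InC C v → does (circuitEdge? (prev v)) ≡ not (does (circuitEdge? v))
  circuitEdge-prev {v} v∈C = does-complement (circuitEdge? (prev v)) (circuitEdge? v)
    (λ before here → ¬circuitEdge-both here before) (Sum.swap (InC⇒circuitEdge v∈C))

  joined⇒InC : ∀ {u v} → Joined u v → InC C u
  joined⇒InC (j , inj₁ (aj≡u , _)) = j , inj₁ aj≡u
  joined⇒InC (j , inj₂ (bj≡u , _)) = j , inj₂ bj≡u

  spoke∉C : ∀ {v} → IsSpoke G v → ¬ InC C v
  spoke∉C spoke (j , inj₂ refl) = notSpoke C j spoke
  spoke∉C spoke (j , inj₁ refl) = a≢b C j (prev j) (sym (begin
    b C (prev j)              ≡⟨ invol G (b C (prev j)) ⟨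
    σ G (σ G (b C (prev j)))  ≡⟨ cong (σ G) (chord C (prev j)) ⟩
    σ G (a C (next (prev j))) ≡⟨ cong (σ G ∘ a C) (next-prev j) ⟩
    σ G (a C j)               ≡⟨ spoke ⟩
    a C j                     ∎))

degree : ∀ {n} {H : Pole3 n} → EdgeSet H → Fin n → ℕ
degree M i = one (mH M (prev i)) + one (mH M i) + one (mQ M i)

spokeMultiplicity : ∀ {n} {H : Pole3 n} → (Fin 4 → EdgeSet H) → Fin n → ℕ
spokeMultiplicity M i =
  one (mQ (M (# 0)) i) + one (mQ (M (# 1)) i) + one (mQ (M (# 2)) i) + one (mQ (M (# 3)) i)

spokeMultiplicity-cong : ∀ {n n′} {H : Pole3 n} {H′ : Pole3 n′} (M : Fin 4 → EdgeSet H)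
                         (M′ : Fin 4 → EdgeSet H′) {i j} → (∀ t → mQ (M t) i ≡ mQ (M′ t) j) →
                         spokeMultiplicity M i ≡ spokeMultiplicity M′ j
spokeMultiplicity-cong M M′ same rewrite same (# 0) | same (# 1) | same (# 2) | same (# 3) = refl

module Proper4CoverProperties {m : ℕ} {G' : Pole3 m} (P : Proper4Cover G') where
  open Proper4Cover P

  usesH⇒≢3 : ∀ {t w} → mH (M t) w ≡ true → t ≢ # 3
  usesH⇒≢3 {w = w} used refl = contradiction (trans (sym used) (proj₁ (M₄=Q w))) λ ()

  avoiding : ∀ w → ∃[ t ] t ≢ # 3 × mH (M t) w ≡ false
  avoiding w with coverH (prev w)
  ... | t , covers-prev = t , usesH⇒≢3 covers-prev , only-one (perfect t w) covers-prev

spokes⇒3≤ : ∀ {n} → Pole3 n → 3 ≤ n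
spokes⇒3≤ G = injective⇒≤ {f = spoke} spoke-injective
  where
  spoke : Fin 3 → Fin _
  spoke zero             = s₁ G
  spoke (suc zero)       = s₂ G
  spoke (suc (suc zero)) = s₃ G

  spoke-injective : Injective _≡_ _≡_ spoke
  spoke-injective {zero}           {zero}           _ = refl
  spoke-injective {zero}           {suc zero}       e = contradiction e (s₁≢s₂ G)
  spoke-injective {zero}           {suc (suc zero)} e = contradiction e (s₁≢s₃ G)
  spoke-injective {suc zero}       {zero}           e = contradiction (sym e) (s₁≢s₂ G)
  spoke-injective {suc zero}       {suc zero}       _ = refl
  spoke-injective {suc zero}       {suc (suc zero)} e = contradiction e (s₂≢s₃ G)
  spoke-injective {suc (suc zero)} {zero}           e = contradiction (sym e) (s₁≢s₃ G)
  spoke-injective {suc (suc zero)} {suc zero}       e = contradiction (sym e) (s₂≢s₃ G)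
  spoke-injective {suc (suc zero)} {suc (suc zero)} _ = refl

module Lift {p m : ℕ} {G : Pole3 (3 + p)} {C : AltCircuit G} {G' : Pole3 (suc m)}
            {f : Fin (suc m) → Fin (3 + p)} (S : IsSuppression G C G' f) where
  open IsSuppression S
  open StrictlyIncreasing f increasing using (f-injective; project; project-image;
                                              project-prev-image; project-prev-gap)
  open Circuit C

  Image : Fin (3 + p) → Set
  Image v = ∃[ j ] f j ≡ v

  image? : ∀ v → Dec (Image v)
  image? v = any? (λ j → f j Fin.≟ v)

  image-elim : ∀ {ℓ} (P : Fin (3 + p) → Set ℓ) → (∀ j → P (f j)) → (∀ {v} → ¬ Image v → P v) →
               ∀ v → P v
  image-elim P onImage onGap v with image? v
  ... | yes (j , refl) = onImage j
  ... | no ∉image      = onGap ∉image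

  f∉C : ∀ j → ¬ InC C (f j)
  f∉C j = Equivalence.from (image (f j)) (j , refl)

  ∉image⇒∈C : ∀ {v} → ¬ Image v → InC C v
  ∉image⇒∈C {v} ∉image = decidable-stable (InC? v) (∉image ∘ Equivalence.to (image v))

  ¬circuitEdge-f : ∀ j → ¬ CircuitEdge (f j)
  ¬circuitEdge-f j = f∉C j ∘ joined⇒InC

  ¬circuitEdge-prev-f : ∀ j → ¬ CircuitEdge (prev (f j))
  ¬circuitEdge-prev-f j e = f∉C j (subst (InC C) (next-prev (f j)) (joined⇒InC (joined-sym e)))

  liftQ : (Fin (suc m) → Bool) → Fin (3 + p) → Bool
  liftQ g v with image? v
  ... | yes (j , _) = g j
  ... | no _        = false

  liftQ-image : ∀ g j → liftQ g (f j) ≡ g j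
  liftQ-image g j with image? (f j)
  ... | yes (k , fk≡fj) = cong g (f-injective fk≡fj)
  ... | no ∉image       = contradiction (j , refl) ∉image

  liftQ-gap : ∀ g {v} → ¬ Image v → liftQ g v ≡ false
  liftQ-gap g {v} ∉image with image? v
  ... | yes v∈image = contradiction v∈image ∉image
  ... | no _        = refl

  liftQ-σ : ∀ g → (∀ j → g (σ G' j) ≡ g j) → ∀ v → liftQ g (σ G v) ≡ liftQ g v
  liftQ-σ g g-σ = image-elim (λ v → liftQ g (σ G v) ≡ liftQ g v) onImage onGap
    where
    onImage : ∀ j → liftQ g (σ G (f j)) ≡ liftQ g (f j)
    onImage j = begin
      liftQ g (σ G (f j))  ≡⟨ cong (liftQ g) (chords j) ⟨
      liftQ g (f (σ G' j)) ≡⟨ liftQ-image g (σ G' j) ⟩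
      g (σ G' j)           ≡⟨ g-σ j ⟩
      g j                  ≡⟨ liftQ-image g j ⟨
      liftQ g (f j)        ∎

    onGap : ∀ {v} → ¬ Image v → liftQ g (σ G v) ≡ liftQ g v
    onGap {v} ∉image = trans (liftQ-gap g σv∉image) (sym (liftQ-gap g ∉image))
      where
      σv∉image : ¬ Image (σ G v)
      σv∉image (j , fj≡σv) = ∉image (σ G' j , trans (chords j) (trans (cong (σ G) fj≡σv) (invol G v)))

  lift : EdgeSet G' → EdgeSet G
  lift M = record
    { mH   = λ i → does (circuitEdge? i) xor mH M (project i)
    ; mQ   = liftQ (mQ M)
    ; mQ-σ = liftQ-σ (mQ M) (mQ-σ M)
    }

  degree-lift-image : ∀ M j → degree (lift M) (f j) ≡ degree M j
  degree-lift-image M j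
    rewrite dec-false (circuitEdge? (prev (f j))) (¬circuitEdge-prev-f j)
          | dec-false (circuitEdge? (f j)) (¬circuitEdge-f j)
          | project-prev-image j | project-image j | liftQ-image (mQ M) j = refl

  degree-lift-gap : ∀ M {v} → ¬ Image v → degree (lift M) v ≡ 1
  degree-lift-gap M {v} ∉image
    rewrite liftQ-gap (mQ M) ∉image | project-prev-gap ∉image
          | circuitEdge-prev (∉image⇒∈C ∉image) =
    one-xor-complement (does (circuitEdge? v)) (mH M (project v))

  lift-perfect : ∀ M → IsPerfectMatching M → IsPerfectMatching (lift M)
  lift-perfect M perfect = image-elim (λ v → degree (lift M) v ≡ 1)
    (λ j → trans (degree-lift-image M j) (perfect j)) (degree-lift-gap M)

  spoke-image : ∀ {v} → IsSpoke G v → ∃[ j ] f j ≡ v × IsSpoke G' j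
  spoke-image {v} spoke with Equivalence.to (image v) (spoke∉C spoke)
  ... | j , fj≡v = j , fj≡v , f-injective (begin
    f (σ G' j) ≡⟨ chords j ⟩
    σ G (f j)  ≡⟨ cong (σ G) fj≡v ⟩
    σ G v      ≡⟨ spoke ⟩
    v          ≡⟨ fj≡v ⟨
    f j        ∎)

  module _ (P : Proper4Cover G') where
    open Proper4Cover P renaming (M to M′; perfect to M′-perfect)
    open Proper4CoverProperties P

    Q : EdgeSet G
    Q = record { mH = λ _ → false ; mQ = λ _ → true ; mQ-σ = λ _ → refl }

    M : Fin 4 → EdgeSet G
    M zero                   = lift (M′ (# 0))
    M (suc zero)             = lift (M′ (# 1))
    M (suc (suc zero))       = lift (M′ (# 2))
    M (suc (suc (suc zero))) = Q

    M≡lift : ∀ t → t ≢ # 3 → M t ≡ lift (M′ t)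
    M≡lift zero                   _   = refl
    M≡lift (suc zero)             _   = refl
    M≡lift (suc (suc zero))       _   = refl
    M≡lift (suc (suc (suc zero))) t≢3 = contradiction refl t≢3

    M-perfect : ∀ t → IsPerfectMatching (M t)
    M-perfect zero                     = lift-perfect (M′ (# 0)) (M′-perfect (# 0))
    M-perfect (suc zero)               = lift-perfect (M′ (# 1)) (M′-perfect (# 1))
    M-perfect (suc (suc zero))         = lift-perfect (M′ (# 2)) (M′-perfect (# 2))
    M-perfect (suc (suc (suc zero))) _ = refl

    lift-coverH : ∀ i → ∃[ t ] t ≢ # 3 × mH (lift (M′ t)) i ≡ true
    lift-coverH i = byCircuitEdge (circuitEdge? i)
      where
      byCircuitEdge : (e? : Dec (CircuitEdge i)) →
                      ∃[ t ] t ≢ # 3 × does e? xor mH (M′ t) (project i) ≡ true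
      byCircuitEdge (yes _) with avoiding (project i)
      ... | t , t≢3 , avoids = t , t≢3 , cong not avoids
      byCircuitEdge (no _) with coverH (project i)
      ... | t , covers = t , usesH⇒≢3 covers , covers

    M-coverH : ∀ i → ∃[ t ] mH (M t) i ≡ true
    M-coverH i with lift-coverH i
    ... | t , t≢3 , covers = t , subst (λ N → mH N i ≡ true) (sym (M≡lift t t≢3)) covers

    M-image : ∀ t j → mQ (M t) (f j) ≡ mQ (M′ t) j
    M-image zero                   j = liftQ-image _ j
    M-image (suc zero)             j = liftQ-image _ j
    M-image (suc (suc zero))       j = liftQ-image _ j
    M-image (suc (suc (suc zero))) j = sym (proj₂ (M₄=Q j))

    M-spokes2 : ∀ v → IsSpoke G v → spokeMultiplicity M v ≡ 2
    M-spokes2 v spoke with spoke-image spoke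
    ... | j , refl , spoke′ = trans (spokeMultiplicity-cong M M′ (λ t → M-image t j)) (spokes2 j spoke′)

    cover : Proper4Cover G
    cover = record
      { M       = M
      ; perfect = M-perfect
      ; M₄=Q    = λ _ → refl , refl
      ; coverH  = M-coverH
      ; coverQ  = λ _ → # 3 , refl
      ; spokes2 = M-spokes2
      }

lemma3p2 : ∀ {n} (G : Pole3 n) (C : AltCircuit G)
           {m} (G' : Pole3 m) (f : Fin m → Fin n) →
           IsSuppression G C G' f →
           Proper4Cover G' → Proper4Cover G
lemma3p2 G C G' f S P with spokes⇒3≤ G | toℕ<n (s₁ G')
... | s≤s (s≤s (s≤s _)) | s≤s _ = Lift.cover S P
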